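{- Let $n\ge 3$ and let $(v_0,\ldots,v_{n-1})$ be a normalized Farey $n$-gon, i.e. $v_0=\frac10=\infty>v_1>\cdots>v_{n-2}>v_{n-1}=\frac01=0$ with consecutive vertices (and $v_{n-1},v_0$) joined by edges of the Farey graph. Extend indices cyclically mod $n$. Then for each vertex $v_i$, the Farey distance $d(v_{i-1},v_{i+1})$ equals the number of triangles incident to $v_i$.
   Context: Rationals are written as irreducible fractions $\frac{p}{r}$ with $r\ge0$, $\infty=\frac10$. The Farey distance is $d(\frac{p_1}{r_1},\frac{p_2}{r_2})=|p_1r_2-p_2r_1|$; the Farey graph on $\mathbb{Q}\cup\{\infty\}$ has an edge between $v,w$ iff $d(v,w)=1$. The Farey edges among the vertices of a Farey $n$-gon triangulate it; the number of triangles incident to a vertex $v_i$ is the number of other vertices of the polygon joined to $v_i$ by a Farey edge, minus $1$. -}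

module Defs where

open import Data.Nat as ℕ using (ℕ; zero; suc; _∸_)
open import Data.Nat.Coprimality using (Coprime)
open import Data.Nat.DivMod using (_mod_)
open import Data.Integer as ℤ using (ℤ; +_; ∣_∣)
open import Data.Fin using (Fin; toℕ; fromℕ; inject₁)
open import Data.List using (List; length; filter; allFin)
open import Data.Product using (_×_; _,_)
open import Data.Sum using (_⊎_)
open import Relation.Nullary using (¬_; Dec; yes; no)
open import Relation.Nullary.Decidable using (_×-dec_; ¬?)
open import Relation.Binary.PropositionalEquality using (_≡_; _≢_)
import Data.Fin as Fin

-- An element of ℚ ∪ {∞} written as an irreducible fraction p/r with r ≥ 0.
record Vtx : Set where
  constructor frac
  field
    num : ℤ
    den : ℕ
    irreducible : Coprime ∣ num ∣ den
open Vtx public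

dist : Vtx → Vtx → ℕ
dist v w = ∣ num v ℤ.* (+ den w) ℤ.- num w ℤ.* (+ den v) ∣

-- Strict order on ℚ ∪ {∞} (only finite elements and ∞ = 1/0 are compared):
-- w < v  iff  (v = ∞ and w finite) or (both finite and p_w/r_w < p_v/r_v).
_<ᵥ_ : Vtx → Vtx → Set
w <ᵥ v = (den v ≡ 0 × num v ≡ + 1 × 0 ℕ.< den w)
       ⊎ (0 ℕ.< den v × 0 ℕ.< den w × num w ℤ.* (+ den v) ℤ.< num v ℤ.* (+ den w))

next : ∀ {k} → Fin (suc k) → Fin (suc k)
next {k} i = (suc (toℕ i)) mod (suc k)

prev : ∀ {k} → Fin (suc k) → Fin (suc k)
prev {k} i = (toℕ i ℕ.+ k) mod (suc k)

record NormalizedFareyPolygon (k : ℕ) (v : Fin (suc k) → Vtx) : Set where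
  field
    first-num : num (v Fin.zero) ≡ + 1
    first-den : den (v Fin.zero) ≡ 0
    last-num  : num (v (fromℕ k)) ≡ + 0
    last-den  : den (v (fromℕ k)) ≡ 1
    decreasing : (i : Fin k) → v (Fin.suc i) <ᵥ v (inject₁ i)
    farey-edges : (i : Fin (suc k)) → dist (v i) (v (next i)) ≡ 1

fareyDegree : ∀ {k} → (Fin (suc k) → Vtx) → Fin (suc k) → ℕ
fareyDegree {k} v i =
  length (filter (λ j → ¬? (j Fin.≟ i) ×-dec (dist (v i) (v j) ℕ.≟ 1)) (allFin (suc k)))

trianglesAt : ∀ {k} → (Fin (suc k) → Vtx) → Fin (suc k) → ℕ
trianglesAt v i = fareyDegree v i ∸ 1

-- Write a vertex p/r as the integer vector (p , r) and let det be the 2×2 determinant, so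
-- that d(v , w) = ∣det v w∣.  The order of the vertices makes det Vⱼ Vₗ > 0 for j < l, and
-- the Farey edges make consecutive determinants equal to 1.  Appending the negated
-- vertices gives vectors L₀ , … , L₂ₖ₊₁ (Lₙ₊ₖ₊₁ = −Lₙ) with all consecutive determinants 1.
-- Fix the vertex x = Lₐ = vᵢ.  The next k vectors Lₐ₊₁ , … , Lₐ₊ₖ are, up to sign, the
-- other vertices; their coordinates Eₙ = det x Lₙ > 0 and Hₙ = det Lₐ₊₁ Lₙ with respect to
-- the basis (x , Lₐ₊₁) form, by the Plücker relation, a unimodular chain running from
-- 0/1 to Hₐ₊ₖ/1.  Such a chain of Farey neighbours meets every integer between its ends
-- exactly once, so the Farey degree of vᵢ (the number of n with Eₙ = 1) is Hₐ₊ₖ + 1,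
-- while ∣Hₐ₊ₖ∣ = d(vᵢ₊₁ , vᵢ₋₁).
module Submission where

open import Defs
open import Data.Nat as ℕ using (ℕ; zero; suc; _∸_; s≤s; z≤n)
import Data.Nat.Properties as ℕP
open import Data.Nat.DivMod using (_mod_; _%_; m≤n⇒m%n≡m; [m+n]%n≡m%n)
open import Data.Integer as ℤ using (ℤ; +_; _+_; _*_; _-_; -_; _≤_; _<_; +≤+; +<+; ∣_∣)
open import Data.Integer.Base using (nonNegative)
import Data.Integer.Properties as ℤP
open import Data.Integer.Tactic.RingSolver using (solve-∀)
open import Data.Fin as Fin using (Fin; toℕ; fromℕ; fromℕ<; inject₁)
import Data.Fin.Properties as FinP
open import Data.List using (length; filter; tabulate)
open import Data.Product using (_×_; _,_; proj₁; proj₂)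
open import Data.Sum using (_⊎_; inj₁; inj₂)
open import Data.Empty using (⊥-elim)
open import Function using (_∘_; id; _⇔_; mk⇔; Equivalence)
open import Relation.Binary using (tri<; tri≈; tri>)
open import Relation.Binary.PropositionalEquality
open import Relation.Nullary using (Dec; yes; no; ¬_)
open import Relation.Nullary.Decidable using (_×-dec_; ¬?)
open import Relation.Unary using (Pred; Decidable)

open Equivalence using (to; from)

Vec2 : Set
Vec2 = ℤ × ℤ

vec : Vtx → Vec2
vec w = num w , + den w

det : Vec2 → Vec2 → ℤ
det (a , b) (c , d) = a * d - c * b

neg : Vec2 → Vec2
neg (a , b) = - a , - b

det-antisym : ∀ x y → det y x ≡ - det x y
det-antisym (a , b) (c , d) = ring a b c d
  where
  ring : ∀ a b c d → c * b - a * d ≡ - (a * d - c * b)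
  ring = solve-∀

det-negʳ : ∀ x y → det x (neg y) ≡ - det x y
det-negʳ (a , b) (c , d) = ring a b c d
  where
  ring : ∀ a b c d → a * - d - - c * b ≡ - (a * d - c * b)
  ring = solve-∀

det-negˡ : ∀ x y → det (neg x) y ≡ - det x y
det-negˡ (a , b) (c , d) = ring a b c d
  where
  ring : ∀ a b c d → - a * d - c * - b ≡ - (a * d - c * b)
  ring = solve-∀

det-neg : ∀ x y → det (neg x) (neg y) ≡ det x y
det-neg (a , b) (c , d) = ring a b c d
  where
  ring : ∀ a b c d → - a * - d - - c * - b ≡ a * d - c * b
  ring = solve-∀

det-self : ∀ x → det x x ≡ + 0
det-self (a , b) = ring a b
  where
  ring : ∀ a b → a * b - a * b ≡ + 0
  ring = solve-∀

-- The Plücker relation: it turns a unimodular sequence of vectors into a unimodular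
-- sequence of coordinate pairs with respect to any basis (x , y).
det-plücker : ∀ x y w z → det x w * det y z - det x z * det y w ≡ det x y * det w z
det-plücker (x₁ , x₂) (y₁ , y₂) (w₁ , w₂) (z₁ , z₂) = ring x₁ x₂ y₁ y₂ w₁ w₂ z₁ z₂
  where
  ring : ∀ x₁ x₂ y₁ y₂ w₁ w₂ z₁ z₂ →
         (x₁ * w₂ - w₁ * x₂) * (y₁ * z₂ - z₁ * y₂) - (x₁ * z₂ - z₁ * x₂) * (y₁ * w₂ - w₁ * y₂)
         ≡ (x₁ * y₂ - y₁ * x₂) * (w₁ * z₂ - z₁ * w₂)
  ring = solve-∀

-- Cross-multiplication identity behind the transitivity of the order of fractions.
det-transfer : ∀ a b c → proj₂ b * det a c ≡ proj₂ c * det a b + proj₂ a * det b c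
det-transfer (a₁ , a₂) (b₁ , b₂) (c₁ , c₂) = ring a₁ a₂ b₁ b₂ c₁ c₂
  where
  ring : ∀ a₁ a₂ b₁ b₂ c₁ c₂ →
         b₂ * (a₁ * c₂ - c₁ * a₂) ≡ c₂ * (a₁ * b₂ - b₁ * a₂) + a₂ * (b₁ * c₂ - c₁ * b₂)
  ring = solve-∀

*-nonNeg : ∀ {i j} → + 0 ≤ i → + 0 ≤ j → + 0 ≤ i * j
*-nonNeg {i} {j} i≥0 j≥0 =
  subst (_≤ i * j) (ℤP.*-zeroʳ i) (ℤP.*-monoˡ-≤-nonNeg i {{nonNegative i≥0}} j≥0)

det-pos-trans : ∀ a b c → + 0 ≤ proj₂ a → + 0 < proj₂ b → + 0 < proj₂ c →
                + 0 < det a b → + 0 < det b c → + 0 < det a c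
det-pos-trans a b c a₂≥0 b₂>0 c₂>0 ab>0 bc>0 =
  ℤP.*-cancelˡ-<-nonNeg (proj₂ b) {{nonNegative (ℤP.<⇒≤ b₂>0)}} (begin-strict
    proj₂ b * + 0                          ≡⟨ ℤP.*-zeroʳ (proj₂ b) ⟩
    + 0                                    <⟨ ℤP.+-mono-<-≤ c₂·ab>0 a₂·bc≥0 ⟩
    proj₂ c * det a b + proj₂ a * det b c  ≡⟨ sym (det-transfer a b c) ⟩
    proj₂ b * det a c                      ∎)
  where
  open ℤP.≤-Reasoning
  c₂·ab>0 : + 0 < proj₂ c * det a b
  c₂·ab>0 = subst (_< proj₂ c * det a b) (ℤP.*-zeroʳ (proj₂ c))
              (ℤP.*-monoˡ-<-pos (proj₂ c) {{ℤ.positive c₂>0}} ab>0)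
  a₂·bc≥0 : + 0 ≤ proj₂ a * det b c
  a₂·bc≥0 = *-nonNeg a₂≥0 (ℤP.<⇒≤ bc>0)

-- y ≈± x: y is x up to sign.  Farey distances only see vectors up to sign.
_≈±_ : Vec2 → Vec2 → Set
y ≈± x = y ≡ x ⊎ y ≡ neg x

∣det∣-±ʳ : ∀ {x y} → y ≈± x → ∀ z → ∣ det z y ∣ ≡ ∣ det z x ∣
∣det∣-±ʳ (inj₁ refl) z = refl
∣det∣-±ʳ {x} (inj₂ refl) z = trans (cong ∣_∣ (det-negʳ z x)) (ℤP.∣-i∣≡∣i∣ (det z x))

∣det∣-±ˡ : ∀ {x y} → y ≈± x → ∀ z → ∣ det y z ∣ ≡ ∣ det x z ∣
∣det∣-±ˡ (inj₁ refl) z = refl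
∣det∣-±ˡ {x} (inj₂ refl) z = trans (cong ∣_∣ (det-negˡ x z)) (ℤP.∣-i∣≡∣i∣ (det x z))

∣det∣-sym : ∀ x y → ∣ det x y ∣ ≡ ∣ det y x ∣
∣det∣-sym x y = sym (trans (cong ∣_∣ (det-antisym x y)) (ℤP.∣-i∣≡∣i∣ (det x y)))

<ᵥ⇒det-pos : ∀ {w x} → w <ᵥ x → + 0 < det (vec x) (vec w)
<ᵥ⇒det-pos {w} (inj₁ (x-den≡0 , x-num≡1 , w-den>0)) rewrite x-den≡0 | x-num≡1 =
  subst (+ 0 <_) (sym (ring (num w) (+ den w))) (+<+ w-den>0)
  where
  ring : ∀ p r → + 1 * r - p * + 0 ≡ r
  ring = solve-∀
<ᵥ⇒det-pos {w} {x} (inj₂ (_ , _ , lt)) =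
  subst (_< det (vec x) (vec w)) (ℤP.+-inverseʳ (num w * + den x)) (ℤP.+-monoˡ-< _ lt)

<ᵥ⇒den-pos : ∀ {w x} → w <ᵥ x → 0 ℕ.< den w
<ᵥ⇒den-pos (inj₁ (_ , _ , w-den>0)) = w-den>0
<ᵥ⇒den-pos (inj₂ (_ , w-den>0 , _)) = w-den>0

indicator : ∀ {p} {P : Set p} → Dec P → ℕ
indicator (yes _) = 1
indicator (no _)  = 0

indicator-cong : ∀ {p q} {P : Set p} {Q : Set q} (d : Dec P) (e : Dec Q) →
                 P ⇔ Q → indicator d ≡ indicator e
indicator-cong (yes _) (yes _) P⇔Q = refl
indicator-cong (yes p) (no ¬q) P⇔Q = ⊥-elim (¬q (to P⇔Q p))
indicator-cong (no ¬p) (yes q) P⇔Q = ⊥-elim (¬p (from P⇔Q q))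
indicator-cong (no _)  (no _)  P⇔Q = refl

indicator-no : ∀ {p} {P : Set p} → ¬ P → (d : Dec P) → indicator d ≡ 0
indicator-no ¬p (yes p) = ⊥-elim (¬p p)
indicator-no ¬p (no _)  = refl

count : ∀ {a p} {A : Set a} {P : Pred A p} → Decidable P → (ℕ → A) → ℕ → ℕ
count P? g zero    = 0
count P? g (suc n) = indicator (P? (g 0)) ℕ.+ count P? (g ∘ suc) n

count-cong : ∀ {a b p q} {A : Set a} {B : Set b} {P : Pred A p} {Q : Pred B q}
             (P? : Decidable P) (Q? : Decidable Q) {g : ℕ → A} {h : ℕ → B} n →
             (∀ j → j ℕ.< n → P (g j) ⇔ Q (h j)) → count P? g n ≡ count Q? h n
count-cong P? Q? zero    P⇔Q = refl
count-cong P? Q? (suc n) P⇔Q =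
  cong₂ ℕ._+_ (indicator-cong (P? _) (Q? _) (P⇔Q 0 (s≤s z≤n)))
              (count-cong P? Q? n (λ j j<n → P⇔Q (suc j) (s≤s j<n)))

module _ {a p} {A : Set a} {P : Pred A p} (P? : Decidable P) where

  count-tabulate : ∀ n (f : Fin n → A) (g : ℕ → A) → (∀ j → g (toℕ j) ≡ f j) →
                   length (filter P? (tabulate f)) ≡ count P? g n
  count-tabulate zero    f g g≡f = refl
  count-tabulate (suc n) f g g≡f rewrite g≡f Fin.zero with P? (f Fin.zero)
  ... | yes _ = cong suc (count-tabulate n (f ∘ Fin.suc) (g ∘ suc) (g≡f ∘ Fin.suc))
  ... | no _  = count-tabulate n (f ∘ Fin.suc) (g ∘ suc) (g≡f ∘ Fin.suc)

  count-ext : ∀ {g h : ℕ → A} → (∀ j → g j ≡ h j) → ∀ n → count P? g n ≡ count P? h n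
  count-ext g≡h zero    = refl
  count-ext g≡h (suc n) =
    cong₂ ℕ._+_ (cong (indicator ∘ P?) (g≡h 0)) (count-ext (g≡h ∘ suc) n)

  count-+ : ∀ (g : ℕ → A) m n →
            count P? g (m ℕ.+ n) ≡ count P? g m ℕ.+ count P? (λ j → g (m ℕ.+ j)) n
  count-+ g zero    n = refl
  count-+ g (suc m) n = trans (cong (indicator (P? (g 0)) ℕ.+_) (count-+ (g ∘ suc) m n))
                              (sym (ℕP.+-assoc (indicator (P? (g 0))) _ _))

  count-rotate : ∀ {g : ℕ → A} {p} → (∀ j → g (p ℕ.+ j) ≡ g j) →
                 ∀ {a} → a ℕ.≤ p → count P? g p ≡ count P? (λ j → g (a ℕ.+ j)) p
  count-rotate {g} periodic {a} a≤p with ℕP.m≤n⇒∃[o]m+o≡n a≤p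
  ... | b , refl = begin
    count P? g (a ℕ.+ b)                                ≡⟨ count-+ g a b ⟩
    count P? g a ℕ.+ count P? g⁺ b                      ≡⟨ ℕP.+-comm (count P? g a) _ ⟩
    count P? g⁺ b ℕ.+ count P? g a                      ≡⟨ cong (count P? g⁺ b ℕ.+_) (count-ext wrap a) ⟩
    count P? g⁺ b ℕ.+ count P? (λ j → g⁺ (b ℕ.+ j)) a  ≡⟨ sym (count-+ g⁺ b a) ⟩
    count P? g⁺ (b ℕ.+ a)                               ≡⟨ cong (count P? g⁺) (ℕP.+-comm b a) ⟩
    count P? g⁺ (a ℕ.+ b)                               ∎
    where
    open ≡-Reasoning
    g⁺ : ℕ → A
    g⁺ j = g (a ℕ.+ j)
    wrap : ∀ j → g j ≡ g⁺ (b ℕ.+ j)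
    wrap j = trans (sym (periodic j)) (cong g (ℕP.+-assoc a b j))

i-j<i : ∀ i {j} → + 0 < j → i - j < i
i-j<i i j>0 = subst (i - _ <_) (ℤP.+-identityʳ i) (ℤP.+-monoʳ-< i (ℤP.neg-mono-< j>0))

-- Consecutive pairs (E j , H j), (E (j+1) , H (j+1)), j < N, have determinant 1: the
-- fractions H j / E j are consecutive Farey neighbours.
Unimodular : (ℕ → ℤ) → (ℕ → ℤ) → ℕ → Set
Unimodular E H N = ∀ j → j ℕ.< N → E j * H (suc j) - E (suc j) * H j ≡ + 1

-- t = ⌈ h / e ⌉ for e > 0, phrased through the remainder: 0 ≤ t e − h < e.
IsCeiling : ℤ → ℤ → ℤ → Set
IsCeiling t h e = + 0 ≤ t * e - h × t * e - h < e

count-ones : (ℕ → ℤ) → ℕ → ℕ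
count-ones = count (λ z → z ℤ.≟ + 1)

count-ones-head : ∀ {E} n → E 0 ≡ + 1 → count-ones E (suc n) ≡ suc (count-ones (E ∘ suc) n)
count-ones-head {E} n E₀≡1 with E 0 ℤ.≟ + 1
... | yes _    = refl
... | no E₀≢1 = ⊥-elim (E₀≢1 E₀≡1)

ceiling-of-integer : ∀ {t h} → IsCeiling t h (+ 1) → h ≡ t
ceiling-of-integer {t} (r≥0 , r<1) =
  trans (sym (ℤP.i-j≡0⇒i≡j _ _ (remainder-zero r≥0 r<1))) (ℤP.*-identityʳ t)
  where
  remainder-zero : ∀ {r} → + 0 ≤ r → r < + 1 → r ≡ + 0
  remainder-zero (+≤+ z≤n) (+<+ (s≤s z≤n)) = refl

ceiling-step-integer : ∀ {t h₀ e₁ h₁} → IsCeiling t h₀ (+ 1) → + 1 * h₁ - e₁ * h₀ ≡ + 1 →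
                       + 0 < e₁ → IsCeiling (t + + 1) h₁ e₁
ceiling-step-integer {t} {h₀} {e₁} {h₁} ceil unimod e₁>0 =
  subst (+ 0 ≤_) (sym remainder) (ℤP.i≤j⇒0≤j-i (ℤP.i<j⇒suc[i]≤j e₁>0)) ,
  subst (_< e₁) (sym remainder) (i-j<i e₁ (+<+ (s≤s z≤n)))
  where
  open ≡-Reasoning
  ring : ∀ t e h → (t + + 1) * e - h ≡ e - (+ 1 * h - e * t)
  ring = solve-∀
  remainder : (t + + 1) * e₁ - h₁ ≡ e₁ - + 1
  remainder = begin
    (t + + 1) * e₁ - h₁        ≡⟨ ring t e₁ h₁ ⟩
    e₁ - (+ 1 * h₁ - e₁ * t)   ≡⟨ cong (λ h → e₁ - (+ 1 * h₁ - e₁ * h)) (sym (ceiling-of-integer ceil)) ⟩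
    e₁ - (+ 1 * h₁ - e₁ * h₀)  ≡⟨ cong (λ d → e₁ - d) unimod ⟩
    e₁ - + 1                   ∎

-- After a non-integral fraction h₀ / e₀ (e₀ ≥ 2) the ceiling does not change: the
-- remainders r = t e₀ − h₀ and r' = t e₁ − h₁ satisfy e₀ r' = e₁ r − 1.
ceiling-step : ∀ {t e₀ h₀ e₁ h₁} → + 2 ≤ e₀ → IsCeiling t h₀ e₀ →
               e₀ * h₁ - e₁ * h₀ ≡ + 1 → + 0 < e₁ → IsCeiling t h₁ e₁
ceiling-step {t} {e₀} {h₀} {e₁} {h₁} e₀≥2 (r≥0 , r<e₀) unimod e₁>0 = r'≥0 , r'<e₁
  where
  open ℤP.≤-Reasoning
  r r' : ℤ
  r  = t * e₀ - h₀
  r' = t * e₁ - h₁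
  e₀≥0 : + 0 ≤ e₀
  e₀≥0 = ℤP.≤-trans (+≤+ z≤n) e₀≥2
  e₁≥0 : + 0 ≤ e₁
  e₁≥0 = ℤP.<⇒≤ e₁>0
  remainders : e₀ * r' ≡ e₁ * r - + 1
  remainders = trans (ring t e₀ e₁ h₀ h₁) (cong (λ d → e₁ * r - d) unimod)
    where
    ring : ∀ t e₀ e₁ h₀ h₁ →
           e₀ * (t * e₁ - h₁) ≡ e₁ * (t * e₀ - h₀) - (e₀ * h₁ - e₁ * h₀)
    ring = solve-∀
  r'≥0 : + 0 ≤ r'
  r'≥0 = ℤP.i<j⇒suc[i]≤j (ℤP.*-cancelˡ-<-nonNeg e₀ {{nonNegative e₀≥0}} (begin-strict
    e₀ * - + 1     ≡⟨ ring e₀ ⟩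
    - e₀           ≤⟨ ℤP.neg-mono-≤ e₀≥2 ⟩
    - + 2          <⟨ ℤ.-<- (s≤s z≤n) ⟩
    - + 1          ≤⟨ ℤP.+-monoʳ-≤ (- + 1) (*-nonNeg e₁≥0 r≥0) ⟩
    - + 1 + e₁ * r ≡⟨ ℤP.+-comm (- + 1) (e₁ * r) ⟩
    e₁ * r - + 1   ≡⟨ sym remainders ⟩
    e₀ * r'        ∎))
    where
    ring : ∀ e → e * - + 1 ≡ - e
    ring = solve-∀
  r'<e₁ : r' < e₁
  r'<e₁ = ℤP.*-cancelˡ-<-nonNeg e₀ {{nonNegative e₀≥0}} (begin-strict
    e₀ * r'               ≡⟨ remainders ⟩
    e₁ * r - + 1          <⟨ i-j<i (e₁ * r) (+<+ (s≤s z≤n)) ⟩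
    e₁ * r                ≤⟨ ℤP.*-monoˡ-≤-nonNeg e₁ {{nonNegative e₁≥0}} (ℤP.i<j⇒i≤pred[j] r<e₀) ⟩
    e₁ * (- + 1 + e₀)     ≡⟨ ring e₀ e₁ ⟩
    e₀ * e₁ - e₁          <⟨ i-j<i (e₀ * e₁) e₁>0 ⟩
    e₀ * e₁               ∎)
    where
    ring : ∀ e₀ e₁ → e₁ * (- + 1 + e₀) ≡ e₀ * e₁ - e₁
    ring = solve-∀

-- The increasing chain of Farey neighbours H j / E j
-- meets each of the integers t , … , H N exactly once, and E j = 1 exactly there:
-- #{ j ≤ N ∣ E j = 1 } = H N − t + 1.
count-ones-chain : ∀ E H N t → Unimodular E H N → (∀ j → j ℕ.≤ N → + 0 < E j) →
                   E N ≡ + 1 → IsCeiling t (H 0) (E 0) → + count-ones E (suc N) ≡ H N - t + + 1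
count-ones-chain E H zero t _ _ E₀≡1 ceil with E 0 ℤ.≟ + 1
... | no E₀≢1 = ⊥-elim (E₀≢1 E₀≡1)
... | yes _   = trans (sym (ring t)) (cong (λ h → h - t + + 1) (sym H₀≡t))
  where
  H₀≡t : H 0 ≡ t
  H₀≡t = ceiling-of-integer (subst (IsCeiling t (H 0)) E₀≡1 ceil)
  ring : ∀ t → t - t + + 1 ≡ + 1
  ring = solve-∀
count-ones-chain E H (suc N) t unimod E>0 E-last ceil with E 0 ℤ.≟ + 1
... | yes E₀≡1 = begin
    + suc (count-ones (E ∘ suc) (suc N))   ≡⟨ ℤP.pos-+ 1 _ ⟩
    + 1 + + count-ones (E ∘ suc) (suc N)   ≡⟨ cong (λ n → + 1 + n) rest ⟩
    + 1 + (H (suc N) - (t + + 1) + + 1)    ≡⟨ ring (H (suc N)) t ⟩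
    H (suc N) - t + + 1                    ∎
  where
  open ≡-Reasoning
  ring : ∀ h t → + 1 + (h - (t + + 1) + + 1) ≡ h - t + + 1
  ring = solve-∀
  rest : + count-ones (E ∘ suc) (suc N) ≡ H (suc N) - (t + + 1) + + 1
  rest = count-ones-chain (E ∘ suc) (H ∘ suc) N (t + + 1)
           (λ j j<N → unimod (suc j) (s≤s j<N)) (λ j j≤N → E>0 (suc j) (s≤s j≤N)) E-last
           (ceiling-step-integer {t} {H 0} {E 1} {H 1} (subst (IsCeiling t (H 0)) E₀≡1 ceil)
              (subst (λ e → e * H 1 - E 1 * H 0 ≡ + 1) E₀≡1 (unimod 0 (s≤s z≤n)))
              (E>0 1 (s≤s z≤n)))
... | no E₀≢1 = count-ones-chain (E ∘ suc) (H ∘ suc) N t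
           (λ j j<N → unimod (suc j) (s≤s j<N)) (λ j j≤N → E>0 (suc j) (s≤s j≤N)) E-last
           (ceiling-step {t} {E 0} {H 0} {E 1} {H 1} E₀≥2 ceil (unimod 0 (s≤s z≤n)) (E>0 1 (s≤s z≤n)))
  where
  E₀≥2 : + 2 ≤ E 0
  E₀≥2 = ℤP.i<j⇒suc[i]≤j (ℤP.≤∧≢⇒< (ℤP.i<j⇒suc[i]≤j (E>0 0 z≤n)) (E₀≢1 ∘ sym))

count-ones-from-origin : ∀ E H N → Unimodular E H N → (∀ j → j ℕ.≤ N → + 0 < E j) →
                         E N ≡ + 1 → E 0 ≡ + 1 → H 0 ≡ + 0 → count-ones E (suc N) ∸ 1 ≡ ∣ H N ∣
count-ones-from-origin E H N unimod E>0 E-last E₀≡1 H₀≡0 =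
  trans (cong (_∸ 1) (count-ones-head {E} N E₀≡1)) (cong ∣_∣ (sym H-last))
  where
  open ≡-Reasoning
  start : IsCeiling (+ 0) (H 0) (E 0)
  start rewrite E₀≡1 | H₀≡0 = +≤+ z≤n , +<+ (s≤s z≤n)
  c : ℕ
  c = count-ones (E ∘ suc) N
  ring : ∀ h → h ≡ h - + 0 + + 1 - + 1
  ring = solve-∀
  H-last : H N ≡ + c
  H-last = begin
    H N                    ≡⟨ ring (H N) ⟩
    H N - + 0 + + 1 - + 1  ≡⟨ cong (_- + 1) (sym (count-ones-chain E H N (+ 0) unimod E>0 E-last start)) ⟩
    + count-ones E (suc N) - + 1  ≡⟨ cong (λ n → + n - + 1) (count-ones-head {E} N E₀≡1) ⟩
    + suc c - + 1          ≡⟨ refl ⟩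
    + c                    ∎

module Polygon (N : ℕ) (v : Fin (suc (suc N)) → Vtx)
               (polygon : NormalizedFareyPolygon (suc N) v) where
  open NormalizedFareyPolygon polygon

  k : ℕ
  k = suc N

  idx : ℕ → Fin (suc k)
  idx n = n mod suc k

  V : ℕ → Vec2
  V n = vec (v (idx n))

  toℕ-idx : ∀ {n} → n ℕ.≤ k → toℕ (idx n) ≡ n
  toℕ-idx n≤k = trans (FinP.toℕ-fromℕ< _) (m≤n⇒m%n≡m n≤k)

  idx-toℕ : ∀ (j : Fin (suc k)) {n} → toℕ j ≡ n → idx n ≡ j
  idx-toℕ j refl = FinP.toℕ-injective (toℕ-idx (FinP.toℕ≤pred[n] j))

  idx-periodic : ∀ n → idx (suc k ℕ.+ n) ≡ idx n
  idx-periodic n = FinP.toℕ-injective (begin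
    toℕ (idx (suc k ℕ.+ n))  ≡⟨ FinP.toℕ-fromℕ< _ ⟩
    (suc k ℕ.+ n) % suc k    ≡⟨ cong (_% suc k) (ℕP.+-comm (suc k) n) ⟩
    (n ℕ.+ suc k) % suc k    ≡⟨ [m+n]%n≡m%n n (suc k) ⟩
    n % suc k                ≡⟨ sym (FinP.toℕ-fromℕ< _) ⟩
    toℕ (idx n)              ∎)
    where open ≡-Reasoning

  V-periodic : ∀ n → V (suc k ℕ.+ n) ≡ V n
  V-periodic n = cong (vec ∘ v) (idx-periodic n)

  V-first : V 0 ≡ (+ 1 , + 0)
  V-first = cong₂ _,_ first-num (cong +_ first-den)

  V-last : V k ≡ (+ 0 , + 1)
  V-last rewrite idx-toℕ (fromℕ k) (FinP.toℕ-fromℕ k) = cong₂ _,_ last-num (cong +_ last-den)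

  ordered-step : ∀ {n} → n ℕ.< k → + 0 < det (V n) (V (suc n)) × + 0 < proj₂ (V (suc n))
  ordered-step {n} n<k
    rewrite idx-toℕ (inject₁ (fromℕ< n<k)) (trans (FinP.toℕ-inject₁ _) (FinP.toℕ-fromℕ< n<k))
          | idx-toℕ (Fin.suc (fromℕ< n<k)) (cong suc (FinP.toℕ-fromℕ< n<k))
    = <ᵥ⇒det-pos {v (Fin.suc j)} {v (inject₁ j)} (decreasing j)
    , +<+ (<ᵥ⇒den-pos {v (Fin.suc j)} {v (inject₁ j)} (decreasing j))
    where
    j : Fin k
    j = fromℕ< n<k

  den-pos : ∀ {n} → 0 ℕ.< n → n ℕ.≤ k → + 0 < proj₂ (V n)
  den-pos {suc n} _ n<k = proj₂ (ordered-step n<k)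

  det-step : ∀ {n} → n ℕ.< k → det (V n) (V (suc n)) ≡ + 1
  det-step {n} n<k = begin
    det (V n) (V (suc n))              ≡⟨ sym (ℤP.0≤i⇒+∣i∣≡i (ℤP.<⇒≤ (proj₁ (ordered-step n<k)))) ⟩
    + ∣ det (V n) (V (suc n)) ∣        ≡⟨ cong (λ j → + dist (v (idx n)) (v j)) (sym next-idx) ⟩
    + dist (v (idx n)) (v (next (idx n))) ≡⟨ cong +_ (farey-edges (idx n)) ⟩
    + 1                                ∎
    where
    open ≡-Reasoning
    next-idx : next (idx n) ≡ idx (suc n)
    next-idx = cong (λ m → suc m mod suc k) (toℕ-idx (ℕP.<⇒≤ n<k))

  det-ordered : ∀ {j l} → j ℕ.< l → l ℕ.≤ k → + 0 < det (V j) (V l)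
  det-ordered {j} {suc l} (s≤s j≤l) l<k with ℕP.m≤n⇒m<n∨m≡n j≤l
  ... | inj₂ refl = proj₁ (ordered-step l<k)
  ... | inj₁ j<l  = det-pos-trans (V j) (V l) (V (suc l)) (+≤+ z≤n)
                      (den-pos (ℕP.≤-<-trans z≤n j<l) (ℕP.<⇒≤ l<k)) (proj₂ (ordered-step l<k))
                      (det-ordered j<l (ℕP.<⇒≤ l<k)) (proj₁ (ordered-step l<k))

  -- Going once around negates the vertices, which makes the
  -- wrap-around step from V k = 0/1 to −V 0 = −1/0 unimodular as well.
  L : ℕ → Vec2
  L n with n ℕ.≤? k
  ... | yes _ = V n
  ... | no _  = neg (V n)

  L-low : ∀ {n} → n ℕ.≤ k → L n ≡ V n
  L-low {n} n≤k with n ℕ.≤? k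
  ... | yes _   = refl
  ... | no n≰k = ⊥-elim (n≰k n≤k)

  L-wrap : ∀ m → L (suc k ℕ.+ m) ≡ neg (V m)
  L-wrap m with suc k ℕ.+ m ℕ.≤? k
  ... | yes k+m<k = ⊥-elim (ℕP.n≮n k (ℕP.≤-trans (ℕP.m≤m+n (suc k) m) k+m<k))
  ... | no _      = cong neg (V-periodic m)

  L-± : ∀ n → L n ≈± V n
  L-± n with n ℕ.≤? k
  ... | yes _ = inj₁ refl
  ... | no _  = inj₂ refl

  det-L-step : ∀ n → n ℕ.≤ k ℕ.+ k → det (L n) (L (suc n)) ≡ + 1
  det-L-step n n≤2k with ℕP.<-cmp n k
  ... | tri< n<k _ _ rewrite L-low (ℕP.<⇒≤ n<k) | L-low n<k = det-step n<k
  ... | tri≈ _ refl _ = begin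
    det (L k) (L (suc k))     ≡⟨ cong₂ det (L-low ℕP.≤-refl) L-after-last ⟩
    det (V k) (neg (V 0))     ≡⟨ cong₂ (λ y z → det y (neg z)) V-last V-first ⟩
    + 1                       ∎
    where
    open ≡-Reasoning
    L-after-last : L (suc k) ≡ neg (V 0)
    L-after-last = trans (cong L (sym (ℕP.+-identityʳ (suc k)))) (L-wrap 0)
  ... | tri> _ _ k<n with ℕP.m≤n⇒∃[o]m+o≡n k<n
  ...   | m , refl = begin
    det (L (suc k ℕ.+ m)) (L (suc (suc k ℕ.+ m)))  ≡⟨ cong (det (L (suc k ℕ.+ m)) ∘ L) (sym (ℕP.+-suc (suc k) m)) ⟩
    det (L (suc k ℕ.+ m)) (L (suc k ℕ.+ suc m))    ≡⟨ cong₂ det (L-wrap m) (L-wrap (suc m)) ⟩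
    det (neg (V m)) (neg (V (suc m)))              ≡⟨ det-neg (V m) (V (suc m)) ⟩
    det (V m) (V (suc m))                          ≡⟨ det-step (ℕP.+-cancelˡ-< k m k n≤2k) ⟩
    + 1                                            ∎
    where open ≡-Reasoning

  module Vertex (i : Fin (suc k)) where
    a : ℕ
    a = toℕ i

    a≤k : a ℕ.≤ k
    a≤k = FinP.toℕ≤pred[n] i

    x : Vec2
    x = V a

    E H : ℕ → ℤ
    E n = det x (L n)
    H n = det (L (suc a)) (L n)

    Eʷ Hʷ : ℕ → ℤ
    Eʷ j = E (a ℕ.+ suc j)
    Hʷ j = H (a ℕ.+ suc j)

    x≡vᵢ : x ≡ vec (v i)
    x≡vᵢ = cong (vec ∘ v) (idx-toℕ i refl)

    E-next : E (suc a) ≡ + 1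
    E-next = trans (cong (λ y → det y (L (suc a))) (sym (L-low a≤k)))
                   (det-L-step a (ℕP.≤-trans a≤k (ℕP.m≤m+n k k)))

    E-pos : ∀ {n} → a ℕ.< n → n ℕ.≤ a ℕ.+ k → + 0 < E n
    E-pos {n} a<n n≤a+k with ℕP.≤-<-connex n k
    ... | inj₁ n≤k = subst (λ y → + 0 < det x y) (sym (L-low n≤k)) (det-ordered a<n n≤k)
    ... | inj₂ k<n with ℕP.m≤n⇒∃[o]m+o≡n k<n
    ...   | m , refl = subst (+ 0 <_) (sym E-wrap) (det-ordered m<a a≤k)
      where
      m<a : m ℕ.< a
      m<a = ℕP.+-cancelˡ-< k m a (subst (suc k ℕ.+ m ℕ.≤_) (ℕP.+-comm a k) n≤a+k)
      E-wrap : E (suc k ℕ.+ m) ≡ det (V m) x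
      E-wrap = trans (cong (det x) (L-wrap m))
                     (trans (det-negʳ x (V m)) (sym (det-antisym x (V m))))

    -- One step after the window the lift returns to −x.
    E-last : E (a ℕ.+ k) ≡ + 1
    E-last = begin
      det x w                  ≡⟨ sym (ℤP.neg-involutive _) ⟩
      - - det x w              ≡⟨ cong -_ (sym (det-antisym x w)) ⟩
      - det w x                ≡⟨ sym (det-negʳ w x) ⟩
      det w (neg x)            ≡⟨ cong (det w) (sym L-after) ⟩
      det w (L (suc (a ℕ.+ k))) ≡⟨ det-L-step (a ℕ.+ k) (ℕP.+-monoˡ-≤ k a≤k) ⟩
      + 1                      ∎
      where
      open ≡-Reasoning
      w : Vec2
      w = L (a ℕ.+ k)
      L-after : L (suc (a ℕ.+ k)) ≡ neg x
      L-after = trans (cong (L ∘ suc) (ℕP.+-comm a k)) (L-wrap a)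

    window-unimodular : Unimodular Eʷ Hʷ N
    window-unimodular j j<N = begin
      Eʷ j * Hʷ (suc j) - Eʷ (suc j) * Hʷ j
        ≡⟨ det-plücker x (L (suc a)) (L n) (L (a ℕ.+ suc (suc j))) ⟩
      E (suc a) * det (L n) (L (a ℕ.+ suc (suc j)))
        ≡⟨ cong₂ _*_ E-next (trans (cong (det (L n) ∘ L) (ℕP.+-suc a (suc j)))
                                   (det-L-step n (ℕP.+-mono-≤ a≤k (ℕP.m≤n⇒m≤1+n j<N)))) ⟩
      + 1                                            ∎
      where
      open ≡-Reasoning
      n : ℕ
      n = a ℕ.+ suc j

    window-pos : ∀ j → j ℕ.≤ N → + 0 < Eʷ j
    window-pos j j≤N = E-pos (ℕP.m<m+n a (s≤s z≤n)) (ℕP.+-monoʳ-≤ a (s≤s j≤N))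

    a+1≡1+a : a ℕ.+ 1 ≡ suc a
    a+1≡1+a = ℕP.+-comm a 1

    Eʷ-first : Eʷ 0 ≡ + 1
    Eʷ-first = trans (cong E a+1≡1+a) E-next

    Hʷ-first : Hʷ 0 ≡ + 0
    Hʷ-first = trans (cong (det (L (suc a)) ∘ L) a+1≡1+a) (det-self (L (suc a)))

    Neighbour : Fin (suc k) → Set
    Neighbour j = ¬ j ≡ i × dist (v i) (v j) ≡ 1

    neighbour? : Decidable Neighbour
    neighbour? j = ¬? (j Fin.≟ i) ×-dec (dist (v i) (v j) ℕ.≟ 1)

    ∣E∣ : ∀ n → ∣ E n ∣ ≡ dist (v i) (v (idx n))
    ∣E∣ n = trans (∣det∣-±ʳ (L-± n) x) (cong (λ y → ∣ det y (V n) ∣) x≡vᵢ)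

    neighbour⇔E≡1 : ∀ {n} → a ℕ.< n → n ℕ.≤ a ℕ.+ k → Neighbour (idx n) ⇔ E n ≡ + 1
    neighbour⇔E≡1 {n} a<n n≤a+k = mk⇔
      (λ (_ , d≡1) → trans (sym (ℤP.0≤i⇒+∣i∣≡i (ℤP.<⇒≤ (E-pos a<n n≤a+k))))
                           (cong +_ (trans (∣E∣ n) d≡1)))
      (λ E≡1 → let d≡1 = trans (sym (∣E∣ n)) (cong ∣_∣ E≡1) in
               (λ idx≡i → ℕP.0≢1+n (trans (sym (cong ∣_∣ (det-self (vec (v i)))))
                                         (subst (λ j → dist (v i) (v j) ≡ 1) idx≡i d≡1)))
               , d≡1)

    degree≡window : fareyDegree v i ≡ count-ones Eʷ k
    degree≡window = begin
      fareyDegree v i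
        ≡⟨ count-tabulate neighbour? (suc k) id idx (λ j → idx-toℕ j refl) ⟩
      count neighbour? idx (suc k)
        ≡⟨ count-rotate neighbour? idx-periodic (ℕP.m≤n⇒m≤1+n a≤k) ⟩
      count neighbour? (λ j → idx (a ℕ.+ j)) (suc k)
        ≡⟨ cong (ℕ._+ count neighbour? (λ j → idx (a ℕ.+ suc j)) k)
             (indicator-no not-self (neighbour? (idx (a ℕ.+ 0)))) ⟩
      count neighbour? (λ j → idx (a ℕ.+ suc j)) k
        ≡⟨ count-cong neighbour? (λ z → z ℤ.≟ + 1) k (λ j j<k →
             neighbour⇔E≡1 (ℕP.m<m+n a (s≤s z≤n)) (ℕP.+-monoʳ-≤ a j<k)) ⟩
      count-ones Eʷ k ∎
      where
      open ≡-Reasoning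
      not-self : ¬ Neighbour (idx (a ℕ.+ 0))
      not-self (idx≢i , _) = idx≢i (idx-toℕ i (sym (ℕP.+-identityʳ a)))

    -- The neighbours vᵢ₋₁ , vᵢ₊₁ of the vertex are, up to sign, the ends of the window.
    neighbours-dist : dist (v (prev i)) (v (next i)) ≡ ∣ Hʷ N ∣
    neighbours-dist = begin
      ∣ det (V (a ℕ.+ k)) (V (suc a)) ∣  ≡⟨ ∣det∣-sym (V (a ℕ.+ k)) (V (suc a)) ⟩
      ∣ det (V (suc a)) (V (a ℕ.+ k)) ∣  ≡⟨ sym (∣det∣-±ʳ (L-± (a ℕ.+ k)) (V (suc a))) ⟩
      ∣ det (V (suc a)) (L (a ℕ.+ k)) ∣  ≡⟨ sym (∣det∣-±ˡ (L-± (suc a)) (L (a ℕ.+ k))) ⟩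
      ∣ det (L (suc a)) (L (a ℕ.+ k)) ∣  ∎
      where open ≡-Reasoning

lemma2p9 : (k : ℕ) → 2 ℕ.≤ k → (v : Fin (suc k) → Vtx) → NormalizedFareyPolygon k v →
    (i : Fin (suc k)) → dist (v (prev i)) (v (next i)) ≡ trianglesAt v i
lemma2p9 zero    () v polygon i
lemma2p9 (suc N) _  v polygon i = begin
  dist (v (prev i)) (v (next i))  ≡⟨ neighbours-dist ⟩
  ∣ Hʷ N ∣                        ≡⟨ sym (count-ones-from-origin Eʷ Hʷ N window-unimodular
                                            window-pos E-last Eʷ-first Hʷ-first) ⟩
  count-ones Eʷ (suc N) ∸ 1       ≡⟨ cong (_∸ 1) (sym degree≡window) ⟩
  trianglesAt v i                 ∎
  where
  open Polygon N v polygon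
  open Vertex i
  open ≡-Reasoning
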